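{- For any integers $k > m \ge 2$ there exist $c>0$ and $n_0$ such that for all $n\ge n_0$, \[ f\left(n,k,\binom{k}{2} - m\cdot \left\lfloor\frac{k}{m+1}\right\rfloor + m+1 \right) \ge c\, n^{1+\frac{1}{m}}, \] that is, $f\left(n,k,\binom{k}{2} - m\left\lfloor\frac{k}{m+1}\right\rfloor + m+1 \right) = \Omega\left(n^{1+1/m}\right)$ as $n\to\infty$ (with $k,m$ fixed).
   Context: For positive integers $n,k,\ell$, let $f(n,k,\ell)$ denote the minimum number of colors used in an edge coloring of the complete graph $K_n$ with the property that for every set of $k$ vertices, the edges of the induced subgraph on these $k$ vertices receive at least $\ell$ distinct colors. -}

module Defs where

open import Data.Nat using (ℕ; suc; _+_; _*_; _∸_; _/_; _^_; _≤_)
open import Relation.Binary.PropositionalEquality using (_≡_)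
open import Data.Nat.Combinatorics using (_C_)
open import Data.Fin using (Fin; _<_; _≟_)
open import Data.Fin.Properties using (_<?_)
open import Data.Fin.Subset using (Subset; _∈_; ∣_∣)
open import Data.Fin.Subset.Properties using (_∈?_)
open import Data.List using (List; filter; cartesianProduct; allFin; deduplicate; length; map)
open import Data.Product using (_×_; _,_; proj₁; proj₂)
open import Relation.Nullary.Decidable using (_×-dec_)

-- An edge colouring of K_n with (at most) r colours: the edge {i,j}, i < j,
-- receives colour χ i j.  (Values χ i j with i ≥ j are irrelevant.)
Colouring : ℕ → ℕ → Set
Colouring n r = Fin n → Fin n → Fin r

edgesIn : ∀ {n} → Subset n → List (Fin n × Fin n)
edgesIn {n} S =
  filter (λ e → (proj₁ e <? proj₂ e) ×-dec ((proj₁ e ∈? S) ×-dec (proj₂ e ∈? S)))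
         (cartesianProduct (allFin n) (allFin n))

numColoursIn : ∀ {n r} → Colouring n r → Subset n → ℕ
numColoursIn χ S = length (deduplicate _≟_ (map (λ e → χ (proj₁ e) (proj₂ e)) (edgesIn S)))

IsKLColouring : ∀ {n r} → ℕ → ℕ → Colouring n r → Set
IsKLColouring {n} k ℓ χ = (S : Subset n) → ∣ S ∣ ≡ k → ℓ ≤ numColoursIn χ S

ellKM : ℕ → ℕ → ℕ
ellKM k m = (k C 2) ∸ m * (k / suc m) + suc m

module Submission where

-- Write ⌊k/(m+1)⌋ = t' + 1, so ℓ = C(k,2) − t'm + 1: a (k,ℓ)-colouring has no
-- k-set spanning ≤ C(k,2) − t'm colours.  A vertex set L whose edges use only
-- colours from a list ys with |ys| + d ≤ C(|L|,2) has "saving d"; savings survive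
-- adding fresh vertices, so no set of ≤ k vertices has saving t'm.
--   * A monochromatic star with t'm + 1 edges has saving t'm, hence every
--     vertex has at most E = t'm neighbours in each colour.
--   * t vertex-disjoint m-stars with the same colour pattern P ∈ [r]^m have
--     saving t'm.  With colour degrees ≤ E a greedy choice finds them as soon as
--     more than N = t'(m+1)(1 + mE) vertices are centres of a P-star.
--   * Double counting ordered m-stars (at least n(n−m−1)^m of them, at most E^m
--     per centre and pattern) then gives n(n−m−1)^m ≤ r^m·E^m·N.

open import Defs
open import Data.Nat using (ℕ; zero; suc; pred; >-nonZero; _+_; _*_; _∸_; _^_; _≤_; _<_; _/_; z≤n; s≤s)
open import Data.Nat.Properties hiding (_≟_; _<?_; <-cmp; <-asym)
open import Data.Nat.Combinatorics using (_C_; nC1≡n; nCk+nC[k+1]≡[n+1]C[k+1])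
open import Data.Nat.DivMod using (m/n*n≤m; m≥n⇒m/n>0)
open import Data.Bool using (Bool; true; false; _∧_; _∨_; not; if_then_else_)
open import Data.Bool.Properties using (∨-assoc)
open import Data.Fin using (Fin; zero; suc; _≟_) renaming (_<_ to _<ᶠ_)
open import Data.Fin.Properties using (_<?_; <-cmp; <-asym) renaming (<⇒≢ to <ᶠ⇒≢)
open import Data.Fin.Subset using (Subset; inside; outside; ∣_∣)
open import Data.Fin.Subset.Properties using (_∈?_)
open import Data.Vec using (lookup) renaming ([] to []ᵥ; _∷_ to _∷ᵥ_)
open import Data.Vec.Properties using ([]=⇒lookup)
open import Data.List using (List; []; _∷_; _++_; map; length; concatMap; deduplicate; cartesianProduct; allFin)
open import Data.List.Properties using (length-map; length-++; ++-identityʳ)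
open import Data.List.Membership.Propositional using (_∈_; find)
open import Data.List.Membership.Propositional.Properties
  using (∈-map⁺; ∈-map⁻; ∈-++⁺ˡ; ∈-++⁺ʳ; ∈-concatMap⁻; ∈-filter⁻; ∈-deduplicate⁻)
open import Data.List.Relation.Unary.Any using (here; there)
import Data.List.Relation.Unary.All as All
open import Data.List.Relation.Unary.Unique.Propositional using (Unique; []; _∷_)
open import Data.List.Relation.Unary.Unique.DecPropositional.Properties using (deduplicate-!)
open import Data.Product using (Σ; _×_; _,_; proj₁; proj₂; ∃-syntax)
open import Data.Sum using (_⊎_; inj₁; inj₂)
open import Data.Unit using (⊤; tt)
open import Data.Empty using (⊥; ⊥-elim)
open import Relation.Binary.PropositionalEquality using (_≡_; _≢_; refl; sym; trans; cong; cong₂; subst; module ≡-Reasoning)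
open import Relation.Binary.Definitions using (tri<; tri≈; tri>)
open import Relation.Nullary using (yes; no; does)
open import Relation.Nullary.Decidable using (_×-dec_)
import Algebra.Properties.CommutativeSemigroup as CommSemigroupProperties

private
  module +-CS = CommSemigroupProperties +-commutativeSemigroup
  module *-CS = CommSemigroupProperties *-commutativeSemigroup

-- Indicator sums over lists.  Counting is done with boolean predicates, so
-- that a count unfolds by evaluating the predicate on each element.

ι : Bool → ℕ
ι true = 1
ι false = 0

false≢true : false ≢ true
false≢true ()

∨-true : ∀ a {b} → b ≡ true → a ∨ b ≡ true
∨-true true _ = refl
∨-true false b = b

∨-false⁻ : ∀ {a b} → a ∨ b ≡ false → a ≡ false × b ≡ false
∨-false⁻ {false} {false} _ = refl , refl

∧-true⁻ : ∀ {a b} → a ∧ b ≡ true → a ≡ true × b ≡ true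
∧-true⁻ {true} {true} _ = refl , refl

not-true : ∀ {b} → not b ≡ true → b ≡ false
not-true {false} _ = refl

module _ {A : Set} where

  sumL : (A → ℕ) → List A → ℕ
  sumL f [] = 0
  sumL f (x ∷ xs) = f x + sumL f xs

  count : (A → Bool) → List A → ℕ
  count p xs = sumL (λ x → ι (p x)) xs

  anyL : (A → Bool) → List A → Bool
  anyL p [] = false
  anyL p (x ∷ xs) = p x ∨ anyL p xs

  filterB : (A → Bool) → List A → List A
  filterB p [] = []
  filterB p (x ∷ xs) = if p x then x ∷ filterB p xs else filterB p xs

  sumL-++ : ∀ f xs ys → sumL f (xs ++ ys) ≡ sumL f xs + sumL f ys
  sumL-++ f [] ys = refl
  sumL-++ f (x ∷ xs) ys = trans (cong (f x +_) (sumL-++ f xs ys)) (sym (+-assoc (f x) _ _))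

  sumL-+ : ∀ f g xs → sumL (λ x → f x + g x) xs ≡ sumL f xs + sumL g xs
  sumL-+ f g [] = refl
  sumL-+ f g (x ∷ xs) = trans (cong (f x + g x +_) (sumL-+ f g xs)) (+-CS.interchange (f x) (g x) _ _)

  sumL-* : ∀ f B xs → sumL (λ x → B * f x) xs ≡ B * sumL f xs
  sumL-* f B [] = sym (*-zeroʳ B)
  sumL-* f B (x ∷ xs) = trans (cong (B * f x +_) (sumL-* f B xs)) (sym (*-distribˡ-+ B (f x) _))

  sumL-cong : ∀ {f g} xs → (∀ x → f x ≡ g x) → sumL f xs ≡ sumL g xs
  sumL-cong [] h = refl
  sumL-cong (x ∷ xs) h = cong₂ _+_ (h x) (sumL-cong xs h)

  sumL-mono : ∀ {f g} xs → (∀ x → f x ≤ g x) → sumL f xs ≤ sumL g xs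
  sumL-mono [] h = z≤n
  sumL-mono (x ∷ xs) h = +-mono-≤ (h x) (sumL-mono xs h)

  sumL-elem : ∀ f {x} xs → x ∈ xs → f x ≤ sumL f xs
  sumL-elem f (y ∷ xs) (here refl) = m≤m+n _ _
  sumL-elem f (y ∷ xs) (there p) = ≤-trans (sumL-elem f xs p) (m≤n+m _ (f y))

  sumL-≤-const : ∀ {f} B xs → (∀ x → x ∈ xs → f x ≤ B) → sumL f xs ≤ length xs * B
  sumL-≤-const B [] h = z≤n
  sumL-≤-const B (x ∷ xs) h = +-mono-≤ (h x (here refl)) (sumL-≤-const B xs (λ y p → h y (there p)))

  sumL-≥-const : ∀ {f} B xs → (∀ x → x ∈ xs → B ≤ f x) → length xs * B ≤ sumL f xs
  sumL-≥-const B [] h = z≤n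
  sumL-≥-const B (x ∷ xs) h = +-mono-≤ (h x (here refl)) (sumL-≥-const B xs (λ y p → h y (there p)))

  count-false : ∀ xs → count (λ _ → false) xs ≡ 0
  count-false [] = refl
  count-false (_ ∷ xs) = count-false xs

  count-mono : ∀ {p q} xs → (∀ x → p x ≡ true → q x ≡ true) → count p xs ≤ count q xs
  count-mono {p} {q} xs h = sumL-mono xs pointwise
    where
    pointwise : ∀ x → ι (p x) ≤ ι (q x)
    pointwise x with p x in px
    ... | false = z≤n
    ... | true rewrite h x px = ≤-refl

  count-∨ : ∀ p q xs → count (λ x → p x ∨ q x) xs ≤ count p xs + count q xs
  count-∨ p q xs = ≤-trans (sumL-mono xs pointwise) (≤-reflexive (sumL-+ _ _ xs))
    where
    pointwise : ∀ x → ι (p x ∨ q x) ≤ ι (p x) + ι (q x)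
    pointwise x with p x
    ... | true = s≤s z≤n
    ... | false = ≤-refl

  count-∨-disjoint : ∀ p q xs → (∀ x → p x ≡ true → q x ≡ false) →
                     count (λ x → p x ∨ q x) xs ≡ count p xs + count q xs
  count-∨-disjoint p q [] h = refl
  count-∨-disjoint p q (x ∷ xs) h with p x in px
  ... | true rewrite h x px = cong suc (count-∨-disjoint p q xs h)
  ... | false = trans (cong (ι (q x) +_) (count-∨-disjoint p q xs h)) (+-CS.x∙yz≈y∙xz (ι (q x)) (count p xs) (count q xs))

  count-not : ∀ p xs → count (λ x → not (p x)) xs + count p xs ≡ length xs
  count-not p [] = refl
  count-not p (x ∷ xs) with p x
  ... | true = trans (+-suc _ _) (cong suc (count-not p xs))
  ... | false = cong suc (count-not p xs)

  count-∧ : ∀ b p xs → count (λ x → b ∧ p x) xs ≡ ι b * count p xs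
  count-∧ true p xs = sym (+-identityʳ _)
  count-∧ false p xs = count-false xs

  witness-of-count-< : ∀ p q xs → count q xs < count p xs → Σ A λ x → p x ≡ true × q x ≡ false
  witness-of-count-< p q [] ()
  witness-of-count-< p q (x ∷ xs) h with p x in px | q x in qx
  ... | true | false = x , px , qx
  ... | true | true = witness-of-count-< p q xs (≤-pred h)
  ... | false | false = witness-of-count-< p q xs h
  ... | false | true = witness-of-count-< p q xs (≤-trans (n≤1+n _) h)

  length-filterB : ∀ p xs → length (filterB p xs) ≡ count p xs
  length-filterB p [] = refl
  length-filterB p (x ∷ xs) with p x
  ... | true = cong suc (length-filterB p xs)
  ... | false = length-filterB p xs

  count-filterB : ∀ p q xs → count q (filterB p xs) ≡ count (λ x → p x ∧ q x) xs
  count-filterB p q [] = refl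
  count-filterB p q (x ∷ xs) with p x
  ... | true = cong (ι (q x) +_) (count-filterB p q xs)
  ... | false = count-filterB p q xs

  ∈-filterB⁺ : ∀ p {z} xs → z ∈ xs → p z ≡ true → z ∈ filterB p xs
  ∈-filterB⁺ p (y ∷ xs) (here refl) pz rewrite pz = here refl
  ∈-filterB⁺ p (y ∷ xs) (there z∈) pz with p y
  ... | true = there (∈-filterB⁺ p xs z∈ pz)
  ... | false = ∈-filterB⁺ p xs z∈ pz

  ∈-filterB⁻ : ∀ p {z} xs → z ∈ filterB p xs → p z ≡ true
  ∈-filterB⁻ p (y ∷ xs) z∈ with p y in py
  ∈-filterB⁻ p (y ∷ xs) (here refl) | true = py
  ∈-filterB⁻ p (y ∷ xs) (there z∈) | true = ∈-filterB⁻ p xs z∈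
  ∈-filterB⁻ p (y ∷ xs) z∈ | false = ∈-filterB⁻ p xs z∈

  anyL-witness : ∀ p xs → anyL p xs ≡ true → Σ A λ x → x ∈ xs × p x ≡ true
  anyL-witness p [] ()
  anyL-witness p (x ∷ xs) h with p x in px
  ... | true = x , here refl , px
  ... | false = let (y , y∈ , py) = anyL-witness p xs h in y , there y∈ , py

  anyL-intro : ∀ p xs x → x ∈ xs → p x ≡ true → anyL p xs ≡ true
  anyL-intro p (y ∷ xs) x (here refl) px rewrite px = refl
  anyL-intro p (y ∷ xs) x (there x∈) px with p y
  ... | true = refl
  ... | false = anyL-intro p xs x x∈ px

  count-pos : ∀ p xs → anyL p xs ≡ true → 1 ≤ count p xs
  count-pos p (x ∷ xs) h with p x
  ... | true = s≤s z≤n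
  ... | false = count-pos p xs h

  count-none : ∀ p xs → anyL p xs ≡ false → count p xs ≡ 0
  count-none p [] h = refl
  count-none p (x ∷ xs) h with p x
  ... | false = count-none p xs h

module _ {A B : Set} where

  sumL-map : ∀ (f : B → ℕ) (h : A → B) xs → sumL f (map h xs) ≡ sumL (λ x → f (h x)) xs
  sumL-map f h [] = refl
  sumL-map f h (x ∷ xs) = cong (f (h x) +_) (sumL-map f h xs)

  sumL-concatMap : ∀ (f : B → ℕ) (g : A → List B) xs → sumL f (concatMap g xs) ≡ sumL (λ x → sumL f (g x)) xs
  sumL-concatMap f g [] = refl
  sumL-concatMap f g (x ∷ xs) = trans (sumL-++ f (g x) _) (cong (sumL f (g x) +_) (sumL-concatMap f g xs))

  length-concatMap : ∀ (g : A → List B) xs → length (concatMap g xs) ≡ sumL (λ x → length (g x)) xs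
  length-concatMap g [] = refl
  length-concatMap g (x ∷ xs) = trans (length-++ (g x)) (cong (length (g x) +_) (length-concatMap g xs))

  sumL-swap : ∀ (g : A → B → ℕ) xs ys → sumL (λ x → sumL (g x) ys) xs ≡ sumL (λ y → sumL (λ x → g x y) xs) ys
  sumL-swap g [] ys = sym (sumL-zero ys)
    where
    sumL-zero : ∀ ys → sumL (λ (_ : B) → 0) ys ≡ 0
    sumL-zero [] = refl
    sumL-zero (_ ∷ ys) = sumL-zero ys
  sumL-swap g (x ∷ xs) ys = trans (cong (sumL (g x) ys +_) (sumL-swap g xs ys)) (sym (sumL-+ (g x) (λ y → sumL (λ x → g x y) xs) ys))

  count-anyL : ∀ (h : A → B → Bool) xs ys → count (λ x → anyL (h x) ys) xs ≤ sumL (λ y → count (λ x → h x y) xs) ys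
  count-anyL h xs [] = ≤-reflexive (count-false xs)
  count-anyL h xs (y ∷ ys) = ≤-trans (count-∨ (λ x → h x y) (λ x → anyL (h x) ys) xs) (+-monoʳ-≤ _ (count-anyL h xs ys))

infix 4 _==_
_==_ : ∀ {n} → Fin n → Fin n → Bool
x == y = does (x ≟ y)

==-refl : ∀ {n} (x : Fin n) → (x == x) ≡ true
==-refl x with x ≟ x
... | yes _ = refl
... | no x≢x = ⊥-elim (x≢x refl)

==⇒≡ : ∀ {n} {x y : Fin n} → (x == y) ≡ true → x ≡ y
==⇒≡ {x = x} {y} h with x ≟ y
... | yes x≡y = x≡y

≢⇒== : ∀ {n} {x y : Fin n} → x ≢ y → (x == y) ≡ false
≢⇒== {x = x} {y} x≢y with x ≟ y
... | yes x≡y = ⊥-elim (x≢y x≡y)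
... | no _ = refl

==-sym : ∀ {n} (x y : Fin n) → (x == y) ≡ (y == x)
==-sym x y with x ≟ y | y ≟ x
... | yes _ | yes _ = refl
... | no _ | no _ = refl
... | yes x≡y | no y≢x = ⊥-elim (y≢x (sym x≡y))
... | no x≢y | yes y≡x = ⊥-elim (x≢y (sym y≡x))

-- The vertices 0, …, n−1 (as allFin, but built with `map suc`, which is what
-- the counting arguments below induct on).
fins : (n : ℕ) → List (Fin n)
fins zero = []
fins (suc n) = zero ∷ map suc (fins n)

length-fins : ∀ n → length (fins n) ≡ n
length-fins zero = refl
length-fins (suc n) = cong suc (trans (length-map suc (fins n)) (length-fins n))

count-fins-suc : ∀ {n} (p : Fin (suc n) → Bool) → count p (fins (suc n)) ≡ ι (p zero) + count (λ x → p (suc x)) (fins n)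
count-fins-suc {n} p = cong (ι (p zero) +_) (sumL-map (λ x → ι (p x)) suc (fins n))

count-== : ∀ {n} (u : Fin n) → count (_== u) (fins n) ≡ 1
count-== {suc n} zero = trans (count-fins-suc {n} (_== zero)) (cong suc (count-false (fins n)))
count-== {suc n} (suc u) = trans (count-fins-suc (_== suc u)) (count-== u)

∈-fins : ∀ {n} (x : Fin n) → x ∈ fins n
∈-fins zero = here refl
∈-fins (suc x) = there (∈-map⁺ suc (∈-fins x))

memb : ∀ {n} → Fin n → List (Fin n) → Bool
memb x L = anyL (x ==_) L

memb⇒∈ : ∀ {n} {x : Fin n} L → memb x L ≡ true → x ∈ L
memb⇒∈ {x = x} L h = let (y , y∈ , x==y) = anyL-witness (x ==_) L h in subst (_∈ L) (sym (==⇒≡ x==y)) y∈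

∈⇒memb : ∀ {n} {x : Fin n} L → x ∈ L → memb x L ≡ true
∈⇒memb {x = x} L x∈ = anyL-intro (x ==_) L x x∈ (==-refl x)

memb-∷ : ∀ {n} {x v : Fin n} L → memb x (v ∷ L) ≡ true → (x ≡ v) ⊎ (memb x L ≡ true)
memb-∷ {x = x} {v} L h with x == v in x==v
... | true = inj₁ (==⇒≡ x==v)
... | false = inj₂ h

memb-++ : ∀ {n} (x : Fin n) A B → memb x (A ++ B) ≡ memb x A ∨ memb x B
memb-++ x [] B = refl
memb-++ x (a ∷ A) B rewrite memb-++ x A B = sym (∨-assoc (x == a) (memb x A) (memb x B))

memb-++-false : ∀ {n} (x : Fin n) A B → memb x A ≡ false → memb x B ≡ false → memb x (A ++ B) ≡ false
memb-++-false x A B a b = trans (memb-++ x A B) (cong₂ _∨_ a b)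

count-memb : ∀ {n} (L : List (Fin n)) → count (λ c → memb c L) (fins n) ≤ length L
count-memb {n} L = ≤-trans (count-anyL _==_ (fins n) L)
  (≤-trans (sumL-≤-const 1 L (λ u _ → ≤-reflexive (count-== u))) (≤-reflexive (*-identityʳ _)))

Dist : ∀ {n} → List (Fin n) → Set
Dist [] = ⊤
Dist (x ∷ L) = memb x L ≡ false × Dist L

Dist-map-suc : ∀ {n} (L : List (Fin n)) → Dist L → Dist (map suc L)
Dist-map-suc [] d = tt
Dist-map-suc (x ∷ L) (x∉L , d) = trans (memb-map-suc x L) x∉L , Dist-map-suc L d
  where
  memb-map-suc : ∀ {n} (x : Fin n) L → memb (suc x) (map suc L) ≡ memb x L
  memb-map-suc x [] = refl
  memb-map-suc x (y ∷ L) = cong ((x == y) ∨_) (memb-map-suc x L)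

Dist-fins : ∀ n → Dist (fins n)
Dist-fins zero = tt
Dist-fins (suc n) = zero∉ (fins n) , Dist-map-suc (fins n) (Dist-fins n)
  where
  zero∉ : ∀ {n} (L : List (Fin n)) → memb zero (map suc L) ≡ false
  zero∉ [] = refl
  zero∉ (y ∷ L) = zero∉ L

count-memb-Dist : ∀ {n} (L : List (Fin n)) → Dist L → count (λ c → memb c L) (fins n) ≡ length L
count-memb-Dist {n} [] d = count-false (fins n)
count-memb-Dist {n} (v ∷ L) (v∉L , d) =
  trans (count-∨-disjoint (_== v) (λ c → memb c L) (fins n) (λ x x==v → subst (λ z → memb z L ≡ false) (sym (==⇒≡ {x = x} {v} x==v)) v∉L))
        (cong₂ _+_ (count-== v) (count-memb-Dist L d))

fresh : ∀ {n} (L : List (Fin n)) → length L < n → Σ (Fin n) λ v → memb v L ≡ false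
fresh {n} L |L|<n = let (v , v∉ , _) = witness-of-count-< (λ c → not (memb c L)) (λ _ → false) (fins n) missing in v , not-true v∉
  where
  positive : ∀ a {b} → b < a + b → 0 < a
  positive zero b<b = ⊥-elim (n≮n _ b<b)
  positive (suc a) _ = s≤s z≤n
  missing : count (λ _ → false) (fins n) < count (λ c → not (memb c L)) (fins n)
  missing rewrite count-false (fins n) =
    positive _ (subst (count (λ c → memb c L) (fins n) <_)
                      (sym (trans (count-not (λ c → memb c L) (fins n)) (length-fins n)))
                      (≤-<-trans (count-memb L) |L|<n))

selectSatisfying : ∀ {n} (p : Fin n → Bool) xs j → Dist xs → j ≤ count p xs →
  Σ (List (Fin n)) λ W → length W ≡ j × Dist W × (∀ w → memb w W ≡ true → p w ≡ true × memb w xs ≡ true)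
selectSatisfying p xs zero d h = [] , refl , tt , λ w ()
selectSatisfying p (x ∷ xs) (suc j) (x∉xs , d) h with p x in px
... | true = let (W , |W| , dW , W⊆) = selectSatisfying p xs j d (≤-pred h) in
  x ∷ W , cong suc |W| , (x∉W W W⊆ , dW) , extend W W⊆
  where
  x∉W : ∀ W → (∀ w → memb w W ≡ true → p w ≡ true × memb w xs ≡ true) → memb x W ≡ false
  x∉W W W⊆ with memb x W in x∈W
  ... | false = refl
  ... | true = ⊥-elim (false≢true (trans (sym x∉xs) (proj₂ (W⊆ x x∈W))))
  extend : ∀ W → (∀ w → memb w W ≡ true → p w ≡ true × memb w xs ≡ true) →
           ∀ w → memb w (x ∷ W) ≡ true → p w ≡ true × memb w (x ∷ xs) ≡ true
  extend W W⊆ w w∈ with w == x in w==x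
  ... | true = subst (λ z → p z ≡ true) (sym (==⇒≡ w==x)) px , refl
  ... | false = W⊆ w w∈
... | false = let (W , |W| , dW , W⊆) = selectSatisfying p xs (suc j) d h in
  W , |W| , dW , λ w w∈ → proj₁ (W⊆ w w∈) , ∨-true (w == x) (proj₂ (W⊆ w w∈))

unique-⊆-length : ∀ {r} (xs ys : List (Fin r)) → Unique xs → (∀ {z} → z ∈ xs → z ∈ ys) → length xs ≤ length ys
unique-⊆-length [] ys u h = z≤n
unique-⊆-length (x ∷ xs) ys (x∉xs ∷ u) h = ≤-trans (s≤s (unique-⊆-length xs others u into-others)) shorter
  where
  others = filterB (λ y → not (x == y)) ys
  into-others : ∀ {z} → z ∈ xs → z ∈ others
  into-others z∈ = ∈-filterB⁺ _ ys (h (there z∈)) (cong not (≢⇒== (All.lookup x∉xs z∈)))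
  shorter : suc (length others) ≤ length ys
  shorter = begin
    suc (length others)                                 ≡⟨ cong suc (length-filterB _ ys) ⟩
    suc (count (λ y → not (x == y)) ys)                 ≡⟨ +-comm 1 _ ⟩
    count (λ y → not (x == y)) ys + 1                   ≤⟨ +-monoʳ-≤ _ (count-pos (x ==_) ys (∈⇒memb ys (h (here refl)))) ⟩
    count (λ y → not (x == y)) ys + count (x ==_) ys    ≡⟨ count-not (x ==_) ys ⟩
    length ys                                           ∎
    where open ≤-Reasoning

toSub : ∀ {n} → (Fin n → Bool) → Subset n
toSub {zero} p = []ᵥ
toSub {suc n} p = (if p zero then inside else outside) ∷ᵥ toSub (λ x → p (suc x))

∣toSub∣ : ∀ {n} (p : Fin n → Bool) → ∣ toSub p ∣ ≡ count p (fins n)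
∣toSub∣ {zero} p = refl
∣toSub∣ {suc n} p with p zero
... | true = cong suc (trans (∣toSub∣ (λ x → p (suc x))) (sym (sumL-map _ suc (fins n))))
... | false = trans (∣toSub∣ (λ x → p (suc x))) (sym (sumL-map _ suc (fins n)))

toSub-inside : ∀ {n} (p : Fin n → Bool) x → lookup (toSub p) x ≡ inside → p x ≡ true
toSub-inside {suc n} p zero h with p zero
... | true = refl
... | false with h
... | ()
toSub-inside {suc n} p (suc x) h = toSub-inside (λ y → p (suc y)) x h

C2-suc : ∀ a → suc a C 2 ≡ a + a C 2
C2-suc a = trans (sym (nCk+nC[k+1]≡[n+1]C[k+1] a 1)) (cong (_+ a C 2) (nC1≡n a))

module Savings {n r : ℕ} (χ : Colouring n r) where

  col : Fin n → Fin n → Fin r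
  col u v with u <? v
  ... | yes _ = χ u v
  ... | no _ = χ v u

  col-< : ∀ {u v} → u <ᶠ v → col u v ≡ χ u v
  col-< {u} {v} u<v with u <? v
  ... | yes _ = refl
  ... | no u≮v = ⊥-elim (u≮v u<v)

  col-> : ∀ {u v} → u <ᶠ v → col v u ≡ χ u v
  col-> {u} {v} u<v with v <? u
  ... | yes v<u = ⊥-elim (<-asym u<v v<u)
  ... | no _ = refl

  col-sym : ∀ u v → col u v ≡ col v u
  col-sym u v with <-cmp u v
  ... | tri< u<v _ _ = trans (col-< u<v) (sym (col-> u<v))
  ... | tri≈ _ refl _ = refl
  ... | tri> _ _ v<u = trans (col-> v<u) (sym (col-< v<u))

  Covers : List (Fin n) → List (Fin r) → Set
  Covers L ys = ∀ x y → memb x L ≡ true → memb y L ≡ true → x ≢ y → col x y ∈ ys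

  Saving : ℕ → List (Fin n) → List (Fin r) → Set
  Saving d L ys = Dist L × Covers L ys × (length ys + d ≤ length L C 2)

  saving-empty : Saving 0 [] []
  saving-empty = tt , (λ x y ()) , z≤n

  -- Adding a vertex v whose edges into L have colours in X ++ ys, with |X| + s ≤ |L|,
  -- increases the saving by s: of the |L| new edges only |X| need new colours.
  addVertex : ∀ {d L ys} → Saving d L ys → (v : Fin n) → memb v L ≡ false → (X : List (Fin r)) →
              (∀ u → memb u L ≡ true → col v u ∈ X ++ ys) → (s : ℕ) → length X + s ≤ length L →
              Saving (d + s) (v ∷ L) (X ++ ys)
  addVertex {d} {L} {ys} (dL , covers , size) v v∉L X new s |X|+s≤ = (v∉L , dL) , covers′ , size′
    where
    covers′ : Covers (v ∷ L) (X ++ ys)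
    covers′ x y x∈ y∈ x≢y with memb-∷ {x = x} {v} L x∈ | memb-∷ {x = y} {v} L y∈
    ... | inj₁ refl | inj₁ refl = ⊥-elim (x≢y refl)
    ... | inj₁ refl | inj₂ y∈L = new y y∈L
    ... | inj₂ x∈L | inj₁ refl = subst (_∈ X ++ ys) (col-sym v x) (new x x∈L)
    ... | inj₂ x∈L | inj₂ y∈L = ∈-++⁺ʳ X (covers x y x∈L y∈L x≢y)
    size′ : length (X ++ ys) + (d + s) ≤ suc (length L) C 2
    size′ = begin
      length (X ++ ys) + (d + s)          ≡⟨ cong (_+ (d + s)) (length-++ X) ⟩
      length X + length ys + (d + s)      ≡⟨ regroup (length X) (length ys) d s ⟩
      (length X + s) + (length ys + d)    ≤⟨ +-mono-≤ |X|+s≤ size ⟩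
      length L + length L C 2             ≡⟨ sym (C2-suc (length L)) ⟩
      suc (length L) C 2                  ∎
      where
      open ≤-Reasoning
      regroup : ∀ a b c e → a + b + (c + e) ≡ (a + e) + (b + c)
      regroup a b c e = trans (cong (a + b +_) (+-comm c e)) (+-CS.interchange a b e c)

  addVertexFully : ∀ {d L ys} → Saving d L ys → (v : Fin n) → memb v L ≡ false → Saving d (v ∷ L) (map (col v) L ++ ys)
  addVertexFully {d} {L} {ys} S v v∉L = subst (λ d′ → Saving d′ (v ∷ L) (map (col v) L ++ ys)) (+-identityʳ d)
    (addVertex S v v∉L (map (col v) L) (λ u u∈ → ∈-++⁺ˡ (∈-map⁺ (col v) (memb⇒∈ {x = u} L u∈))) 0
      (≤-reflexive (trans (+-identityʳ _) (length-map (col v) L))))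

  addVertices : ∀ {d L ys} → Saving d L ys → (ls : List (Fin n)) → Dist ls → (∀ l → memb l ls ≡ true → memb l L ≡ false) →
                Σ (List (Fin r)) λ ys′ → Saving d (ls ++ L) ys′ × (∀ {z} → z ∈ ys → z ∈ ys′)
  addVertices S [] _ _ = _ , S , λ z∈ → z∈
  addVertices {L = L} S (l ∷ ls) (l∉ls , dls) fresh-ls =
    let (ys₁ , S₁ , ⊆₁) = addVertices S ls dls (λ l′ l′∈ → fresh-ls l′ (∨-true (l′ == l) l′∈)) in
    _ , addVertexFully S₁ l (memb-++-false l ls L l∉ls (fresh-ls l (subst (λ b → b ∨ memb l ls ≡ true) (sym (==-refl l)) refl))) ,
    λ z∈ → ∈-++⁺ʳ _ (⊆₁ z∈)

  padTo : ∀ {d L ys} k → Saving d L ys → length L ≤ k → k ≤ n →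
          Σ (List (Fin n)) λ L′ → Σ (List (Fin r)) λ ys′ → Saving d L′ ys′ × length L′ ≡ k
  padTo {L = L} k S |L|≤k k≤n = pad (k ∸ length L) S (m+[n∸m]≡n |L|≤k)
    where
    pad : ∀ {d L ys} g → Saving d L ys → length L + g ≡ k →
          Σ (List (Fin n)) λ L′ → Σ (List (Fin r)) λ ys′ → Saving d L′ ys′ × length L′ ≡ k
    pad {L = L} {ys} zero S h = L , ys , S , trans (sym (+-identityʳ _)) h
    pad {L = L} (suc g) S h with fresh L (≤-trans (≤-trans (s≤s (m≤m+n (length L) g)) (≤-reflexive (trans (sym (+-suc (length L) g)) h))) k≤n)
    ... | v , v∉L = pad g (addVertexFully S v v∉L) (trans (sym (+-suc (length L) g)) h)

  colours-of-saving : ∀ {d L ys} → Saving d L ys → numColoursIn χ (toSub (λ x → memb x L)) ≤ length ys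
  colours-of-saving {d} {L} {ys} (_ , covers , _) = unique-⊆-length _ ys (deduplicate-! _≟_ _) seen⊆ys
    where
    S = toSub (λ x → memb x L)
    seen⊆ys : ∀ {z} → z ∈ deduplicate _≟_ (map (λ e → χ (proj₁ e) (proj₂ e)) (edgesIn S)) → z ∈ ys
    seen⊆ys {z} z∈ with ∈-map⁻ (λ e → χ (proj₁ e) (proj₂ e)) (∈-deduplicate⁻ _≟_ (map (λ e → χ (proj₁ e) (proj₂ e)) (edgesIn S)) z∈)
    ... | (i , j) , e∈ , refl with ∈-filter⁻ (λ e → (proj₁ e <? proj₂ e) ×-dec ((proj₁ e ∈? S) ×-dec (proj₂ e ∈? S))) {xs = cartesianProduct (allFin n) (allFin n)} e∈
    ... | _ , (i<j , i∈ , j∈) =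
      subst (_∈ ys) (col-< i<j) (covers i j (toSub-inside _ i ([]=⇒lookup i∈)) (toSub-inside _ j ([]=⇒lookup j∈)) (<ᶠ⇒≢ i<j))

  size-of-saving : ∀ {d L ys} → Saving d L ys → ∣ toSub (λ x → memb x L) ∣ ≡ length L
  size-of-saving {L = L} (dL , _ , _) = trans (∣toSub∣ (λ x → memb x L)) (count-memb-Dist L dL)

  saving-bound : ∀ {d L ys} k ℓ → IsKLColouring k ℓ χ → Saving d L ys → length L ≡ k → ℓ + d ≤ k C 2
  saving-bound {d} {L} {ys} k ℓ kl S@(_ , _ , size) |L|≡k = begin
    ℓ + d            ≤⟨ +-monoˡ-≤ d (≤-trans (kl _ (trans (size-of-saving S) |L|≡k)) (colours-of-saving S)) ⟩
    length ys + d    ≤⟨ size ⟩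
    length L C 2     ≡⟨ cong (_C 2) |L|≡k ⟩
    k C 2            ∎
    where open ≤-Reasoning

ellKM-+-saving : ∀ k m t′ → k / suc m ≡ suc t′ → m * suc t′ ≤ k C 2 → ellKM k m + t′ * m ≡ suc (k C 2)
ellKM-+-saving k m t′ k/m+1 fits = begin
  (k C 2 ∸ m * (k / suc m) + suc m) + t′ * m  ≡⟨ cong (λ z → (k C 2 ∸ m * z + suc m) + t′ * m) k/m+1 ⟩
  (k C 2 ∸ M + suc m) + t′ * m                ≡⟨ +-suc-shuffle (k C 2 ∸ M) m (t′ * m) ⟩
  suc (k C 2 ∸ M + (m + t′ * m))              ≡⟨ cong (λ z → suc (k C 2 ∸ M + z)) (sym (*-suc-comm m t′)) ⟩
  suc (k C 2 ∸ M + M)                         ≡⟨ cong suc (m∸n+n≡m fits) ⟩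
  suc (k C 2)                                 ∎
  where
  open ≡-Reasoning
  M = m * suc t′
  +-suc-shuffle : ∀ a b c → a + suc b + c ≡ suc (a + (b + c))
  +-suc-shuffle a b c = trans (+-assoc a (suc b) c) (+-suc a (b + c))
  *-suc-comm : ∀ m t → m * suc t ≡ m + t * m
  *-suc-comm m t = trans (*-suc m t) (cong (m +_) (*-comm m t))

module Stars {n r : ℕ} (χ : Colouring n r) where
  open Savings χ

  tuples : ℕ → List (Fin n) → List (List (Fin n))
  tuples zero avoid = [] ∷ []
  tuples (suc j) avoid = concatMap (λ x → map (x ∷_) (tuples j (x ∷ avoid))) (filterB (λ x → not (memb x avoid)) (fins n))

  tuples-spec : ∀ j avoid ls → ls ∈ tuples j avoid →
    length ls ≡ j × Dist ls × (∀ x → memb x ls ≡ true → memb x avoid ≡ false)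
  tuples-spec zero avoid .[] (here refl) = refl , tt , λ x ()
  tuples-spec (suc j) avoid ls ls∈ with find (∈-concatMap⁻ (λ x → map (x ∷_) (tuples j (x ∷ avoid))) {xs = filterB (λ x → not (memb x avoid)) (fins n)} ls∈)
  ... | x , x∈ , ls∈′ with ∈-map⁻ (x ∷_) ls∈′
  ... | ls′ , ls′∈ , refl with tuples-spec j (x ∷ avoid) ls′ ls′∈
  ... | |ls′| , dls′ , avoids = cong suc |ls′| , (x∉ls′ , dls′) , avoids′
    where
    x∉avoid : memb x avoid ≡ false
    x∉avoid = not-true (∈-filterB⁻ (λ x → not (memb x avoid)) (fins n) x∈)
    x∉ls′ : memb x ls′ ≡ false
    x∉ls′ with memb x ls′ in x∈ls′
    ... | false = refl
    ... | true = ⊥-elim (false≢true (trans (sym (avoids x x∈ls′)) (cong (_∨ memb x avoid) (==-refl x))))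
    avoids′ : ∀ y → memb y (x ∷ ls′) ≡ true → memb y avoid ≡ false
    avoids′ y y∈ with y == x in y==x
    ... | true = subst (λ z → memb z avoid ≡ false) (sym (==⇒≡ {x = y} {x} y==x)) x∉avoid
    ... | false = proj₂ (∨-false⁻ (avoids y y∈))

  tuples-many : ∀ j avoid → (n ∸ (length avoid + j)) ^ j ≤ length (tuples j avoid)
  tuples-many zero avoid = ≤-refl
  tuples-many (suc j) avoid = begin
    (n ∸ (a + suc j)) * (n ∸ (a + suc j)) ^ j
      ≤⟨ *-mono-≤ (≤-trans (∸-monoʳ-≤ n (m≤m+n a (suc j))) enough-candidates) (≤-reflexive (cong (λ z → (n ∸ z) ^ j) (+-suc a j))) ⟩
    length candidates * (n ∸ (suc a + j)) ^ j
      ≤⟨ sumL-≥-const _ candidates (λ x _ → tuples-many j (x ∷ avoid)) ⟩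
    sumL (λ x → length (tuples j (x ∷ avoid))) candidates
      ≡⟨ sumL-cong candidates (λ x → sym (length-map (x ∷_) (tuples j (x ∷ avoid)))) ⟩
    sumL (λ x → length (map (x ∷_) (tuples j (x ∷ avoid)))) candidates
      ≡⟨ sym (length-concatMap (λ x → map (x ∷_) (tuples j (x ∷ avoid))) candidates) ⟩
    length (tuples (suc j) avoid) ∎
    where
    open ≤-Reasoning
    a = length avoid
    candidates = filterB (λ x → not (memb x avoid)) (fins n)
    #free = count (λ x → not (memb x avoid)) (fins n)
    #avoided = count (λ c → memb c avoid) (fins n)
    enough-candidates : n ∸ a ≤ length candidates
    enough-candidates = begin
      n ∸ a                  ≡⟨ cong (_∸ a) (trans (sym (length-fins n)) (sym (count-not (λ c → memb c avoid) (fins n)))) ⟩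
      #free + #avoided ∸ a   ≤⟨ ∸-monoʳ-≤ (#free + #avoided) (count-memb avoid) ⟩
      #free + #avoided ∸ #avoided ≡⟨ m+n∸n≡m #free #avoided ⟩
      #free                ≡⟨ sym (length-filterB _ (fins n)) ⟩
      length candidates      ∎

  matches : Fin n → List (Fin r) → List (Fin n) → Bool
  matches c [] [] = true
  matches c [] (_ ∷ _) = false
  matches c (_ ∷ _) [] = false
  matches c (p ∷ P) (x ∷ ls) = (col c x == p) ∧ matches c P ls

  matches⇒pattern : ∀ c P ls → matches c P ls ≡ true → P ≡ map (col c) ls
  matches⇒pattern c [] [] h = refl
  matches⇒pattern c (p ∷ P) (x ∷ ls) h with col c x == p in cx==p
  ... | true = cong₂ _∷_ (sym (==⇒≡ cx==p)) (matches⇒pattern c P ls h)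

  colourDegree : Fin n → Fin r → ℕ
  colourDegree c a = count (λ x → not (x == c) ∧ (col c x == a)) (fins n)

  stars-per-pattern : ∀ E j avoid P c → memb c avoid ≡ true → (∀ a → colourDegree c a ≤ E) →
                      count (matches c P) (tuples j avoid) ≤ E ^ j
  stars-per-pattern E zero avoid [] c c∈ deg = ≤-refl
  stars-per-pattern E zero avoid (p ∷ P) c c∈ deg = z≤n
  stars-per-pattern E (suc j) avoid [] c c∈ deg =
    ≤-trans (≤-reflexive no-stars) z≤n
    where
    candidates = filterB (λ x → not (memb x avoid)) (fins n)
    none : ∀ x → count (matches c []) (map (x ∷_) (tuples j (x ∷ avoid))) ≡ ι false
    none x = trans (sumL-map _ (x ∷_) (tuples j (x ∷ avoid))) (count-false (tuples j (x ∷ avoid)))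
    no-stars : count (matches c []) (tuples (suc j) avoid) ≡ 0
    no-stars = trans (sumL-concatMap (λ ls → ι (matches c [] ls)) (λ (x : Fin n) → map (x ∷_) (tuples j (x ∷ avoid))) candidates)
                     (trans (sumL-cong candidates none) (count-false candidates))
  stars-per-pattern E (suc j) avoid (p ∷ P) c c∈ deg = begin
    count (matches c (p ∷ P)) (tuples (suc j) avoid)
      ≡⟨ sumL-concatMap (λ ls → ι (matches c (p ∷ P) ls)) (λ (x : Fin n) → map (x ∷_) (tuples j (x ∷ avoid))) candidates ⟩
    sumL (λ x → count (matches c (p ∷ P)) (map (x ∷_) (tuples j (x ∷ avoid)))) candidates
      ≡⟨ sumL-cong candidates first-edge ⟩
    sumL (λ x → ι (col c x == p) * count (matches c P) (tuples j (x ∷ avoid))) candidates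
      ≤⟨ sumL-mono candidates (λ x → *-monoʳ-≤ (ι (col c x == p)) (stars-per-pattern E j (x ∷ avoid) P c (∨-true (c == x) c∈) deg)) ⟩
    sumL (λ x → ι (col c x == p) * E ^ j) candidates
      ≡⟨ trans (sumL-cong candidates (λ x → *-comm (ι (col c x == p)) (E ^ j))) (sumL-* (λ x → ι (col c x == p)) (E ^ j) candidates) ⟩
    E ^ j * count (λ x → col c x == p) candidates
      ≡⟨ cong (E ^ j *_) (count-filterB _ _ (fins n)) ⟩
    E ^ j * count (λ x → not (memb x avoid) ∧ (col c x == p)) (fins n)
      ≤⟨ *-monoʳ-≤ (E ^ j) (≤-trans (count-mono (fins n) not-centre) (deg p)) ⟩
    E ^ j * E
      ≡⟨ *-comm (E ^ j) E ⟩
    E ^ suc j ∎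
    where
    open ≤-Reasoning
    candidates = filterB (λ x → not (memb x avoid)) (fins n)
    first-edge : ∀ x → count (matches c (p ∷ P)) (map (x ∷_) (tuples j (x ∷ avoid))) ≡ ι (col c x == p) * count (matches c P) (tuples j (x ∷ avoid))
    first-edge x = trans (sumL-map _ (x ∷_) (tuples j (x ∷ avoid))) (count-∧ (col c x == p) (matches c P) (tuples j (x ∷ avoid)))
    not-centre : ∀ x → not (memb x avoid) ∧ (col c x == p) ≡ true → not (x == c) ∧ (col c x == p) ≡ true
    not-centre x h with memb x avoid in x∈ | x == c in x==c
    ... | false | false = h
    ... | false | true = ⊥-elim (false≢true (trans (sym x∈) (subst (λ z → memb z avoid ≡ true) (sym (==⇒≡ {x = x} {c} x==c)) c∈)))

  patterns : ℕ → List (List (Fin r))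
  patterns zero = [] ∷ []
  patterns (suc j) = concatMap (λ a → map (a ∷_) (patterns j)) (fins r)

  length-patterns : ∀ j → length (patterns j) ≤ r ^ j
  length-patterns zero = ≤-refl
  length-patterns (suc j) = begin
    length (patterns (suc j))                              ≡⟨ length-concatMap _ (fins r) ⟩
    sumL (λ a → length (map (a ∷_) (patterns j))) (fins r) ≤⟨ sumL-≤-const (r ^ j) (fins r) (λ a _ → ≤-trans (≤-reflexive (length-map (a ∷_) (patterns j))) (length-patterns j)) ⟩
    length (fins r) * r ^ j                                ≡⟨ cong (_* r ^ j) (length-fins r) ⟩
    r * r ^ j                                              ∎
    where open ≤-Reasoning

  length-pattern : ∀ j P → P ∈ patterns j → length P ≡ j
  length-pattern zero .[] (here refl) = refl
  length-pattern (suc j) P P∈ with find (∈-concatMap⁻ (λ a → map (a ∷_) (patterns j)) {xs = fins r} P∈)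
  ... | a , _ , P∈′ with ∈-map⁻ (a ∷_) P∈′
  ... | P′ , P′∈ , refl = cong suc (length-pattern j P′ P′∈)

  some-pattern-matches : ∀ c j ls → length ls ≡ j → 1 ≤ sumL (λ P → ι (matches c P ls)) (patterns j)
  some-pattern-matches c zero [] refl = ≤-refl
  some-pattern-matches c (suc j) (x ∷ ls) refl = begin
    1                                                            ≤⟨ some-pattern-matches c j ls refl ⟩
    sumL (λ P → ι (matches c P ls)) (patterns j)                 ≡⟨ sym extend-by-first-colour ⟩
    sumL (λ P → ι (matches c P (x ∷ ls))) (map (col c x ∷_) (patterns j))
      ≤⟨ sumL-elem (λ a → sumL (λ P → ι (matches c P (x ∷ ls))) (map (a ∷_) (patterns j))) (fins r) (∈-fins (col c x)) ⟩
    sumL (λ a → sumL (λ P → ι (matches c P (x ∷ ls))) (map (a ∷_) (patterns j))) (fins r)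
      ≡⟨ sym (sumL-concatMap (λ P → ι (matches c P (x ∷ ls))) (λ (a : Fin r) → map (a ∷_) (patterns j)) (fins r)) ⟩
    sumL (λ P → ι (matches c P (x ∷ ls))) (patterns (suc j))     ∎
    where
    open ≤-Reasoning
    extend-by-first-colour : sumL (λ P → ι (matches c P (x ∷ ls))) (map (col c x ∷_) (patterns j)) ≡ sumL (λ P → ι (matches c P ls)) (patterns j)
    extend-by-first-colour = trans (sumL-map _ (col c x ∷_) (patterns j))
      (cong (λ b → sumL (λ P → ι (b ∧ matches c P ls)) (patterns j)) (==-refl (col c x)))

  starsAt : ℕ → Fin n → List (List (Fin n))
  starsAt m c = tuples m (c ∷ [])

  centreOf : ℕ → List (Fin r) → Fin n → Bool
  centreOf m P c = anyL (matches c P) (starsAt m c)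

  count-stars : ∀ m E → (∀ c a → colourDegree c a ≤ E) →
    n * (n ∸ (1 + m)) ^ m ≤ sumL (λ P → E ^ m * count (centreOf m P) (fins n)) (patterns m)
  count-stars m E deg = begin
    n * (n ∸ (1 + m)) ^ m
      ≡⟨ cong (_* (n ∸ (1 + m)) ^ m) (sym (length-fins n)) ⟩
    length (fins n) * (n ∸ (1 + m)) ^ m
      ≤⟨ sumL-≥-const _ (fins n) (λ c _ → tuples-many m (c ∷ [])) ⟩
    sumL (λ c → length (starsAt m c)) (fins n)
      ≤⟨ sumL-mono (fins n) stars-by-pattern ⟩
    sumL (λ c → sumL (λ P → count (matches c P) (starsAt m c)) (patterns m)) (fins n)
      ≤⟨ sumL-mono (fins n) (λ c → sumL-mono (patterns m) (λ P → at-most-E^m c P)) ⟩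
    sumL (λ c → sumL (λ P → E ^ m * ι (centreOf m P c)) (patterns m)) (fins n)
      ≡⟨ sumL-swap (λ c P → E ^ m * ι (centreOf m P c)) (fins n) (patterns m) ⟩
    sumL (λ P → sumL (λ c → E ^ m * ι (centreOf m P c)) (fins n)) (patterns m)
      ≡⟨ sumL-cong (patterns m) (λ P → sumL-* (λ c → ι (centreOf m P c)) (E ^ m) (fins n)) ⟩
    sumL (λ P → E ^ m * count (centreOf m P) (fins n)) (patterns m) ∎
    where
    open ≤-Reasoning
    stars-by-pattern : ∀ c → length (starsAt m c) ≤ sumL (λ P → count (matches c P) (starsAt m c)) (patterns m)
    stars-by-pattern c = begin
      length (starsAt m c)                                           ≡⟨ sym (*-identityʳ _) ⟩
      length (starsAt m c) * 1                                       ≤⟨ sumL-≥-const 1 (starsAt m c) (λ ls ls∈ → some-pattern-matches c m ls (proj₁ (tuples-spec m (c ∷ []) ls ls∈))) ⟩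
      sumL (λ ls → sumL (λ P → ι (matches c P ls)) (patterns m)) (starsAt m c) ≡⟨ sumL-swap (λ ls P → ι (matches c P ls)) (starsAt m c) (patterns m) ⟩
      sumL (λ P → count (matches c P) (starsAt m c)) (patterns m)   ∎
    at-most-E^m : ∀ c P → count (matches c P) (starsAt m c) ≤ E ^ m * ι (centreOf m P c)
    at-most-E^m c P with anyL (matches c P) (starsAt m c) in any-star
    ... | true = ≤-trans (stars-per-pattern E m (c ∷ []) P c (cong (_∨ false) (==-refl c)) (deg c)) (≤-reflexive (sym (*-identityʳ _)))
    ... | false = ≤-reflexive (trans (count-none (matches c P) (starsAt m c) any-star) (sym (*-zeroʳ (E ^ m))))

  -- Vertices that cannot be the centre of a new P-star disjoint from L: those in
  -- L, and those joined to some u ∈ L by an edge with a colour of P.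
  blocked : List (Fin r) → List (Fin n) → Fin n → Bool
  blocked P L c = memb c L ∨ anyL (λ u → not (c == u) ∧ anyL (λ a → col u c == a) P) L

  count-blocked : ∀ E P L → (∀ c a → colourDegree c a ≤ E) → count (blocked P L) (fins n) ≤ length L * (1 + length P * E)
  count-blocked E P L deg = begin
    count (blocked P L) (fins n)
      ≤⟨ count-∨ _ _ (fins n) ⟩
    count (λ c → memb c L) (fins n) + count (λ c → anyL (λ u → not (c == u) ∧ anyL (λ a → col u c == a) P) L) (fins n)
      ≤⟨ +-mono-≤ (count-memb L) (count-anyL (λ c u → not (c == u) ∧ anyL (λ a → col u c == a) P) (fins n) L) ⟩
    length L + sumL (λ u → count (λ c → not (c == u) ∧ anyL (λ a → col u c == a) P) (fins n)) L
      ≤⟨ +-monoʳ-≤ (length L) (sumL-≤-const (length P * E) L (λ u _ → joined-to u)) ⟩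
    length L + length L * (length P * E)
      ≡⟨ cong (_+ length L * (length P * E)) (sym (*-identityʳ (length L))) ⟩
    length L * 1 + length L * (length P * E)
      ≡⟨ sym (*-distribˡ-+ (length L) 1 _) ⟩
    length L * (1 + length P * E) ∎
    where
    open ≤-Reasoning
    ∧-anyL : ∀ b (f : Fin r → Bool) xs → b ∧ anyL f xs ≡ true → anyL (λ a → b ∧ f a) xs ≡ true
    ∧-anyL true f xs h = h
    joined-to : ∀ u → count (λ c → not (c == u) ∧ anyL (λ a → col u c == a) P) (fins n) ≤ length P * E
    joined-to u = ≤-trans (count-mono (fins n) (λ c h → ∧-anyL (not (c == u)) (λ a → col u c == a) P h))
                 (≤-trans (count-anyL (λ c a → not (c == u) ∧ (col u c == a)) (fins n) P)
                   (sumL-≤-const E P (λ a _ → deg u a)))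

  FreshStar : List (Fin r) → List (Fin n) → Fin n → List (Fin n) → Set
  FreshStar P L c ls = Dist ls × memb c ls ≡ false × P ≡ map (col c) ls ×
                       memb c L ≡ false × (∀ l → memb l ls ≡ true → memb l L ≡ false)

  -- If more than |L|(1 + mE) vertices centre a P-star, one of them centres a P-star
  -- avoiding L (a vertex that is not blocked has no leaf in L).
  freshStar : ∀ m E P L → length P ≡ m → (∀ c a → colourDegree c a ≤ E) →
              length L * (1 + m * E) < count (centreOf m P) (fins n) →
              Σ (Fin n) λ c → Σ (List (Fin n)) λ ls → length ls ≡ m × FreshStar P L c ls
  freshStar m E P L |P| deg many
    with witness-of-count-< (centreOf m P) (blocked P L) (fins n)
           (≤-<-trans (≤-trans (count-blocked E P L deg) (≤-reflexive (cong (λ z → length L * (1 + z * E)) |P|))) many)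
  ... | c , centre , unblocked with anyL-witness (matches c P) (starsAt m c) centre
  ... | ls , ls∈ , match with tuples-spec m (c ∷ []) ls ls∈
  ... | |ls| , dls , leaves-avoid-c = c , ls , |ls| , dls , c∉ls , colours-of-star , proj₁ (∨-false⁻ unblocked) , leaves∉L
    where
    colours-of-star : P ≡ map (col c) ls
    colours-of-star = matches⇒pattern c P ls match
    c∉ls : memb c ls ≡ false
    c∉ls with memb c ls in c∈ls
    ... | false = refl
    ... | true = ⊥-elim (false≢true (trans (sym (leaves-avoid-c c c∈ls)) (cong (_∨ false) (==-refl c))))
    leaves∉L : ∀ l → memb l ls ≡ true → memb l L ≡ false
    leaves∉L l l∈ls with memb l L in l∈L
    ... | false = refl
    ... | true = ⊥-elim (false≢true (trans (sym (proj₂ (∨-false⁻ unblocked))) (anyL-intro _ L l (memb⇒∈ L l∈L) joined)))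
      where
      l≢c : (l == c) ≡ false
      l≢c = proj₁ (∨-false⁻ (leaves-avoid-c l l∈ls))
      joined : not (c == l) ∧ anyL (λ a → col l c == a) P ≡ true
      joined rewrite ==-sym c l | l≢c =
        anyL-intro _ P (col l c)
          (subst (col l c ∈_) (sym colours-of-star) (subst (_∈ map (col c) ls) (col-sym c l) (∈-map⁺ (col c) (memb⇒∈ {x = l} ls l∈ls))))
          (==-refl (col l c))

  firstStar : ∀ P (c : Fin n) ls → Dist ls → memb c ls ≡ false → P ≡ map (col c) ls →
    Σ (List (Fin r)) λ ys → Saving 0 (c ∷ ls ++ []) ys × (∀ {a} → a ∈ P → a ∈ ys)
  firstStar P c ls dls c∉ls colours-of-star =
    let (ys₁ , S₁ , _) = addVertices saving-empty ls dls (λ l _ → refl) in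
    _ , addVertexFully S₁ c (memb-++-false c ls [] c∉ls refl) ,
    λ {a} a∈P → ∈-++⁺ˡ (subst (λ z → a ∈ map (col c) z) (sym (++-identityʳ ls)) (subst (a ∈_) colours-of-star a∈P))

  -- A further fresh m-star with the already recorded pattern P adds saving m:
  -- its m edges reuse the colours of P.
  anotherStar : ∀ {d L ys} m P → Saving d L ys → (c : Fin n) (ls : List (Fin n)) → length ls ≡ m →
    FreshStar P L c ls → (∀ {a} → a ∈ P → a ∈ ys) →
    Σ (List (Fin r)) λ ys′ → Saving (d + m) (c ∷ ls ++ L) ys′ × (∀ {a} → a ∈ P → a ∈ ys′)
  anotherStar {d} {L} {ys} m P S c ls |ls| (dls , c∉ls , colours-of-star , c∉L , ls∉L) P⊆ys =
    let (ys₁ , S₁ , ⊆₁) = addVertices S ls dls ls∉L in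
    _ , addVertex S₁ c (memb-++-false c ls L c∉ls c∉L) (map (col c) L) (edges-of-c ys₁ ⊆₁) m
          (≤-reflexive (trans (cong (_+ m) (length-map (col c) L)) (trans (+-comm (length L) m) (trans (cong (_+ length L) (sym |ls|)) (sym (length-++ ls))))))
      , λ a∈ → ∈-++⁺ʳ _ (⊆₁ (P⊆ys a∈))
    where
    edges-of-c : ∀ ys₁ → (∀ {z} → z ∈ ys → z ∈ ys₁) → ∀ u → memb u (ls ++ L) ≡ true → col c u ∈ map (col c) L ++ ys₁
    edges-of-c ys₁ ⊆₁ u u∈ with memb u ls in u∈ls
    ... | true = ∈-++⁺ʳ _ (⊆₁ (P⊆ys (subst (col c u ∈_) (sym colours-of-star) (∈-map⁺ (col c) (memb⇒∈ {x = u} ls u∈ls)))))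
    ... | false = ∈-++⁺ˡ (∈-map⁺ (col c) (memb⇒∈ {x = u} L (trans (cong (_∨ memb u L) (sym u∈ls)) (trans (sym (memb-++ u ls L)) u∈))))

  disjointStars : ∀ m E P t′ → length P ≡ m → (∀ c a → colourDegree c a ≤ E) →
    t′ * suc m * (1 + m * E) < count (centreOf m P) (fins n) →
    ∀ i → i ≤ t′ → Σ (List (Fin n)) λ L → Σ (List (Fin r)) λ ys →
      Saving (i * m) L ys × length L ≡ suc i * suc m × (∀ {a} → a ∈ P → a ∈ ys)
  disjointStars m E P t′ |P| deg many zero _ with freshStar m E P [] |P| deg (≤-<-trans z≤n many)
  ... | c , ls , |ls| , (dls , c∉ls , colours-of-star , _) with firstStar P c ls dls c∉ls colours-of-star
  ... | ys , S , P⊆ys = c ∷ ls ++ [] , ys , S , cong suc (trans (cong length (++-identityʳ ls)) (trans |ls| (sym (+-identityʳ m)))) , P⊆ys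
  disjointStars m E P t′ |P| deg many (suc i) i<t′ with disjointStars m E P t′ |P| deg many i (≤-trans (n≤1+n i) i<t′)
  ... | L , ys , S , |L| , P⊆ys with freshStar m E P L |P| deg
            (≤-<-trans (≤-trans (≤-reflexive (cong (_* (1 + m * E)) |L|)) (*-monoˡ-≤ (1 + m * E) (*-monoˡ-≤ (suc m) i<t′))) many)
  ... | c , ls , |ls| , star with anotherStar m P S c ls |ls| star P⊆ys
  ... | ys′ , S′ , P⊆ys′ = c ∷ ls ++ L , ys′ , subst (λ d → Saving d (c ∷ ls ++ L) ys′) (+-comm (i * m) m) S′ ,
        cong suc (trans (length-++ ls) (cong₂ _+_ |ls| |L|)) , P⊆ys′

pred≤C2 : ∀ k → k ∸ 1 ≤ k C 2
pred≤C2 zero = z≤n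
pred≤C2 (suc a) = subst (a ≤_) (sym (C2-suc a)) (m≤m+n a _)

module MainBound {n r : ℕ} (χ : Colouring n r) (k m t′ : ℕ) (1≤m : 1 ≤ m)
                 (k/m+1 : k / suc m ≡ suc t′) (t[m+1]≤k : suc m * suc t′ ≤ k) (k≤n : k ≤ n)
                 (kl : IsKLColouring k (ellKM k m) χ) where
  open Savings χ
  open Stars χ

  E N : ℕ
  E = t′ * m
  N = t′ * suc m * (1 + m * E)

  -- No set of at most k vertices has saving t'm (pad it to k vertices and compare
  -- with ℓ(k,m) + t'm = C(k,2) + 1).
  no-saving : ∀ {L ys} → Saving E L ys → length L ≤ k → ⊥
  no-saving S |L|≤k with padTo k S |L|≤k k≤n
  ... | L′ , ys′ , S′ , |L′| = 1+n≰n (subst (_≤ k C 2) (ellKM-+-saving k m t′ k/m+1 fits) (saving-bound k (ellKM k m) kl S′ |L′|))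
    where
    m[t′+1]<k : suc (m * suc t′) ≤ k
    m[t′+1]<k = ≤-trans (s≤s (m≤n+m (m * suc t′) t′)) t[m+1]≤k
    fits : m * suc t′ ≤ k C 2
    fits = ≤-trans (∸-monoˡ-≤ 1 m[t′+1]<k) (pred≤C2 k)

  -- Every colour degree is at most t'm: otherwise u with t'm + 1 neighbours in
  -- colour a spans t'm + 2 ≤ k vertices with saving t'm.
  colour-degree-bound : ∀ u a → colourDegree u a ≤ E
  colour-degree-bound u a = ≮⇒≥ monochromatic-star
    where
    monochromatic-star : E < colourDegree u a → ⊥
    monochromatic-star many with selectSatisfying (λ x → not (x == u) ∧ (col u x == a)) (fins n) (suc E) (Dist-fins n) many
    ... | W , |W| , dW , W⊆ with addVertices saving-empty W dW (λ _ _ → refl)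
    ... | ys , S , _ = no-saving star-saving (≤-trans (s≤s (≤-reflexive |W++[]|)) two-more)
      where
      |W++[]| : length (W ++ []) ≡ suc E
      |W++[]| = trans (cong length (++-identityʳ W)) |W|
      u∉W : memb u W ≡ false
      u∉W with memb u W in u∈W
      ... | false = refl
      ... | true = ⊥-elim (false≢true (trans (sym (cong (λ b → not b ∧ (col u u == a)) (==-refl u))) (proj₁ (W⊆ u u∈W))))
      edges-in-colour-a : ∀ w → memb w (W ++ []) ≡ true → col u w ∈ a ∷ ys
      edges-in-colour-a w w∈ with memb w W in w∈W
      ... | true = here (==⇒≡ (proj₂ (∧-true⁻ (proj₁ (W⊆ w w∈W)))))
      ... | false = ⊥-elim (false≢true (trans (sym (memb-++-false w W [] w∈W refl)) w∈))
      star-saving : Saving E (u ∷ W ++ []) (a ∷ ys)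
      star-saving = addVertex S u (memb-++-false u W [] u∉W refl) (a ∷ []) edges-in-colour-a E (≤-reflexive (sym |W++[]|))
      two-more : suc (suc E) ≤ k
      two-more = ≤-trans (s≤s (≤-trans (+-mono-≤ 1≤m (≤-reflexive (*-comm t′ m)))
                                 (≤-trans (≤-reflexive (sym (*-suc m t′))) (m≤n+m _ t′)))) t[m+1]≤k

  -- No pattern has more than N centres: otherwise t' + 1 disjoint P-stars span
  -- (t'+1)(m+1) ≤ k vertices with saving t'm.
  centres-bound : ∀ P → P ∈ patterns m → count (centreOf m P) (fins n) ≤ N
  centres-bound P P∈ = ≮⇒≥ λ many →
    let (L , ys , S , |L| , _) = disjointStars m E P t′ (length-pattern m P P∈) colour-degree-bound many t′ ≤-refl
    in no-saving S (≤-trans (≤-reflexive |L|) (subst (_≤ k) (*-comm (suc m) (suc t′)) t[m+1]≤k))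

  main-bound : n * (n ∸ suc m) ^ m ≤ r ^ m * (E ^ m * N)
  main-bound = begin
    n * (n ∸ suc m) ^ m
      ≤⟨ count-stars m E colour-degree-bound ⟩
    sumL (λ P → E ^ m * count (centreOf m P) (fins n)) (patterns m)
      ≤⟨ sumL-≤-const (E ^ m * N) (patterns m) (λ P P∈ → *-monoʳ-≤ (E ^ m) (centres-bound P P∈)) ⟩
    length (patterns m) * (E ^ m * N)
      ≤⟨ *-monoˡ-≤ _ (length-patterns m) ⟩
    r ^ m * (E ^ m * N) ∎
    where open ≤-Reasoning

^-distribʳ-* : ∀ a b j → (a * b) ^ j ≡ a ^ j * b ^ j
^-distribʳ-* a b zero = refl
^-distribʳ-* a b (suc j) = trans (cong (a * b *_) (^-distribʳ-* a b j)) ([m*n]*[o*p]≡[m*o]*[n*p] a b (a ^ j) (b ^ j))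

-- From n(n−m−1)^m ≤ r^m·K and n ≥ 2(m+1) (so n ≤ 2(n−m−1)) follows
-- n^{m+1} ≤ (2(K+1)·r)^m, i.e. the statement's form with p = 1, q = 2(K+1).
normalise-bound : ∀ m n r K → 1 ≤ m → 2 * suc m ≤ n → n * (n ∸ suc m) ^ m ≤ r ^ m * K →
                  1 ^ m * n ^ suc m ≤ (2 * suc K * r) ^ m
normalise-bound m n r K 1≤m 2[m+1]≤n bound = begin
  1 ^ m * n ^ suc m              ≡⟨ trans (cong (_* n ^ suc m) (^-zeroˡ m)) (*-identityˡ _) ⟩
  n * n ^ m                      ≤⟨ *-monoʳ-≤ n (^-monoˡ-≤ m n≤2n′) ⟩
  n * (2 * n′) ^ m               ≡⟨ cong (n *_) (^-distribʳ-* 2 n′ m) ⟩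
  n * (2 ^ m * n′ ^ m)           ≡⟨ *-CS.x∙yz≈y∙xz n (2 ^ m) (n′ ^ m) ⟩
  2 ^ m * (n * n′ ^ m)           ≤⟨ *-monoʳ-≤ (2 ^ m) bound ⟩
  2 ^ m * (r ^ m * K)            ≤⟨ *-monoʳ-≤ (2 ^ m) (*-monoʳ-≤ (r ^ m) K≤[K+1]^m) ⟩
  2 ^ m * (r ^ m * suc K ^ m)    ≡⟨ *-CS.x∙yz≈xz∙y (2 ^ m) (r ^ m) (suc K ^ m) ⟩
  2 ^ m * suc K ^ m * r ^ m      ≡⟨ sym (trans (^-distribʳ-* (2 * suc K) r m) (cong (_* r ^ m) (^-distribʳ-* 2 (suc K) m))) ⟩
  (2 * suc K * r) ^ m            ∎
  where
  open ≤-Reasoning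
  n′ = n ∸ suc m
  m+1≤n : suc m ≤ n
  m+1≤n = ≤-trans (m≤m+n (suc m) _) (≤-trans (≤-reflexive (sym (+-assoc (suc m) (suc m) 0))) (≤-trans (≤-reflexive (+-identityʳ _)) (≤-trans (≤-reflexive (cong (suc m +_) (sym (+-identityʳ (suc m))))) 2[m+1]≤n)))
  m+1≤n′ : suc m ≤ n′
  m+1≤n′ = subst (_≤ n′) (m+n∸n≡m (suc m) (suc m)) (∸-monoˡ-≤ (suc m) (≤-trans (≤-reflexive (cong (suc m +_) (sym (+-identityʳ (suc m))))) 2[m+1]≤n))
  n≤2n′ : n ≤ 2 * n′
  n≤2n′ = begin
    n               ≡⟨ sym (m+[n∸m]≡n m+1≤n) ⟩
    suc m + n′      ≤⟨ +-monoˡ-≤ n′ m+1≤n′ ⟩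
    n′ + n′         ≡⟨ cong (n′ +_) (sym (+-identityʳ n′)) ⟩
    2 * n′          ∎
  K≤[K+1]^m : K ≤ suc K ^ m
  K≤[K+1]^m = ≤-trans (n≤1+n K) (≤-trans (≤-reflexive (sym (*-identityʳ (suc K)))) (^-monoʳ-≤ (suc K) 1≤m))

theorem1p1 : (k m : ℕ) → 2 ≤ m → m < k →
    ∃[ p ] ∃[ q ] ∃[ n₀ ] (1 ≤ p × 1 ≤ q ×
      ((n : ℕ) → n₀ ≤ n → (r : ℕ) (χ : Colouring n r) → IsKLColouring (k) (ellKM k m) χ →
        p ^ m * n ^ suc m ≤ (q * r) ^ m))
theorem1p1 k m 2≤m m<k = 1 , 2 * suc K , k + 2 * suc m , s≤s z≤n , s≤s z≤n , bound
  where
  t′ = pred (k / suc m)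
  K = (t′ * m) ^ m * (t′ * suc m * (1 + m * (t′ * m)))
  1≤m : 1 ≤ m
  1≤m = ≤-trans (s≤s z≤n) 2≤m
  k/m+1 : k / suc m ≡ suc t′
  k/m+1 = sym (suc-pred (k / suc m) {{>-nonZero (m≥n⇒m/n>0 {k} {suc m} m<k)}})
  t[m+1]≤k : suc m * suc t′ ≤ k
  t[m+1]≤k = subst (_≤ k) (trans (cong (_* suc m) k/m+1) (*-comm (suc t′) (suc m))) (m/n*n≤m k (suc m))
  bound : (n : ℕ) → k + 2 * suc m ≤ n → (r : ℕ) (χ : Colouring n r) → IsKLColouring k (ellKM k m) χ →
          1 ^ m * n ^ suc m ≤ (2 * suc K * r) ^ m
  bound n n₀≤n r χ kl = normalise-bound m n r K 1≤m (≤-trans (m≤n+m _ k) n₀≤n)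
    (MainBound.main-bound χ k m t′ 1≤m k/m+1 t[m+1]≤k (≤-trans (m≤m+n k _) n₀≤n) kl)
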